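{- Let $d$ be an integer. The negative polynomial Pell equation $$P^2(X)-(X^2+d)\,Q^2(X)=-1$$ has a non-trivial solution with $P(X),Q(X)\in\mathbb{Z}[X]$ if and only if $d=1$.
   Context: A solution is a pair of polynomials $P(X),Q(X)\in\mathbb{Z}[X]$ satisfying the equation identically; it is non-trivial if $Q(X)\neq 0$. -}

module Defs where

open import Data.Integer using (ℤ; +_; -[1+_]; -_) renaming (_+_ to _+ℤ_; _*_ to _*ℤ_)
open import Data.List using (List; []; _∷_)
open import Data.List.Relation.Unary.All using (All)
open import Relation.Binary.PropositionalEquality using (_≡_)
open import Relation.Nullary using (¬_)

-- Polynomials in ℤ[X] as coefficient lists, lowest degree first:
-- a₀ ∷ a₁ ∷ … represents a₀ + a₁ X + …  (trailing zeros allowed).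
Poly : Set
Poly = List ℤ

infixl 6 _⊕_
infixl 7 _⊛_ _·_

_⊕_ : Poly → Poly → Poly
[]       ⊕ q        = q
(a ∷ p)  ⊕ []       = a ∷ p
(a ∷ p)  ⊕ (b ∷ q)  = (a +ℤ b) ∷ (p ⊕ q)

_·_ : ℤ → Poly → Poly
c · []      = []
c · (a ∷ p) = (c *ℤ a) ∷ (c · p)

⊖_ : Poly → Poly
⊖ p = (- (+ 1)) · p

_⊛_ : Poly → Poly → Poly
[]      ⊛ q = []
(a ∷ p) ⊛ q = (a · q) ⊕ (+ 0 ∷ (p ⊛ q))

IsZero : Poly → Set
IsZero p = All (λ a → a ≡ + 0) p

_≈ₚ_ : Poly → Poly → Set
p ≈ₚ q = IsZero (p ⊕ ⊖ q)

const : ℤ → Poly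
const c = c ∷ []

X²+ : ℤ → Poly
X²+ d = d ∷ + 0 ∷ + 1 ∷ []

PellSolution : ℤ → Poly → Poly → Set
PellSolution d P Q = ((P ⊛ P) ⊕ ⊖ (X²+ d ⊛ (Q ⊛ Q))) ≈ₚ const (- (+ 1))

HasNontrivialSolution : ℤ → Set
HasNontrivialSolution d =
  Σ' Poly (λ P → Σ' Poly (λ Q → PellSolution d P Q × ¬ IsZero Q))
  where
    open import Data.Product using (_×_) renaming (Σ to Σ')

{-# OPTIONS --safe #-}
module Submission where

-- Reduce modulo X² + d, i.e. evaluate at the class α of X in ℤ[α] = ℤ[X]/(X² + d).
-- Any solution, trivial or not, then gives P(α)² = −1; writing P(α) = u + vα this
-- says u² − dv² = −1 and 2uv = 0. As u² = −1 is impossible, u = 0 and dv² = 1, so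
-- d = 1. Conversely P = X, Q = 1 solves the equation for d = 1.

open import Defs
open import Data.Integer using (ℤ; +_; -[1+_]; -_; _+_; _*_; ∣_∣; 0ℤ; 1ℤ; -1ℤ)
open import Data.Integer.Properties
  using ( pos-*; -1*i≡-i; i-j≡0⇒i≡j; neg-injective; +-identityˡ; +-identityʳ; *-zeroʳ
        ; i*j≡0⇒i≡0∨j≡0)
open import Data.Integer.Tactic.RingSolver using (solve)
import Data.Nat as ℕ
open import Data.Nat.Properties using (m*n≡1⇒m≡1)
open import Data.Product using (_×_; _,_)
open import Data.Sum using (_⊎_; inj₁; inj₂)
open import Data.List using ([]; _∷_)
import Data.List.Relation.Unary.All as All
open import Relation.Nullary using (contradiction)
open import Relation.Binary.PropositionalEquality
  using (_≡_; _≢_; refl; sym; trans; cong; cong₂; module ≡-Reasoning)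
open import Function.Bundles using (_⇔_; mk⇔)

i*i≢-1 : ∀ i → i * i ≢ -1ℤ
i*i≢-1 (+ n) eq with trans (pos-* n n) eq
... | ()
i*i≢-1 -[1+ n ] ()

i*+n≡1⇒i≡1 : ∀ i n → i * + n ≡ 1ℤ → i ≡ 1ℤ
i*+n≡1⇒i≡1 (+ m)     n       eq = cong +_ (m*n≡1⇒m≡1 m n (cong ∣_∣ (trans (pos-* m n) eq)))
i*+n≡1⇒i≡1 -[1+ m ]  ℕ.zero  eq with trans (sym (*-zeroʳ -[1+ m ])) eq
... | ()
i*+n≡1⇒i≡1 -[1+ m ] (ℕ.suc n) ()

i*[j*j]≡1⇒i≡1 : ∀ i j → i * (j * j) ≡ 1ℤ → i ≡ 1ℤ
i*[j*j]≡1⇒i≡1 i (+ n) eq = i*+n≡1⇒i≡1 i (n ℕ.* n) (trans (cong (i *_) (pos-* n n)) eq)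
i*[j*j]≡1⇒i≡1 i -[1+ n ]  = i*+n≡1⇒i≡1 i _

ij+ji≡0⇒i≡0∨j≡0 : ∀ i j → i * j + j * i ≡ 0ℤ → i ≡ 0ℤ ⊎ j ≡ 0ℤ
ij+ji≡0⇒i≡0∨j≡0 i j eq with i*j≡0⇒i≡0∨j≡0 (+ 2) (trans double eq)
  where
  double : + 2 * (i * j) ≡ i * j + j * i
  double = solve (i ∷ j ∷ [])
... | inj₂ ij≡0 = i*j≡0⇒i≡0∨j≡0 i ij≡0

module Evaluation (d : ℤ) where

  infixl 6 _+ᵅ_
  infixl 7 _*ᵅ_ _·ᵅ_

  -- ⟪ u , v ⟫ stands for u + v α, where α² = - d.
  data ℤ[α] : Set where
    ⟪_,_⟫ : ℤ → ℤ → ℤ[α]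

  ⟪,⟫-injective : ∀ {a b c e} → ⟪ a , b ⟫ ≡ ⟪ c , e ⟫ → a ≡ c × b ≡ e
  ⟪,⟫-injective refl = refl , refl

  0ᵅ : ℤ[α]
  0ᵅ = ⟪ 0ℤ , 0ℤ ⟫

  ι : ℤ → ℤ[α]
  ι a = ⟪ a , 0ℤ ⟫

  α : ℤ[α]
  α = ⟪ 0ℤ , 1ℤ ⟫

  _+ᵅ_ : ℤ[α] → ℤ[α] → ℤ[α]
  ⟪ a , b ⟫ +ᵅ ⟪ c , e ⟫ = ⟪ a + c , b + e ⟫

  _·ᵅ_ : ℤ → ℤ[α] → ℤ[α]
  c ·ᵅ ⟪ a , b ⟫ = ⟪ c * a , c * b ⟫

  _*ᵅ_ : ℤ[α] → ℤ[α] → ℤ[α]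
  ⟪ a , b ⟫ *ᵅ ⟪ c , e ⟫ = ⟪ a * c + - (d * (b * e)) , a * e + b * c ⟫

  +ᵅ-identityˡ : ∀ x → 0ᵅ +ᵅ x ≡ x
  +ᵅ-identityˡ ⟪ u , v ⟫ = cong₂ ⟪_,_⟫ (+-identityˡ u) (+-identityˡ v)

  +ᵅ-identityʳ : ∀ x → x +ᵅ 0ᵅ ≡ x
  +ᵅ-identityʳ ⟪ u , v ⟫ = cong₂ ⟪_,_⟫ (+-identityʳ u) (+-identityʳ v)

  ·ᵅ-zeroʳ : ∀ c → c ·ᵅ 0ᵅ ≡ 0ᵅ
  ·ᵅ-zeroʳ c = cong₂ ⟪_,_⟫ (*-zeroʳ c) (*-zeroʳ c)

  *ᵅ-zeroˡ : ∀ x → 0ᵅ *ᵅ x ≡ 0ᵅ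
  *ᵅ-zeroˡ ⟪ u , v ⟫ = cong₂ ⟪_,_⟫ (solve (v ∷ d ∷ [])) refl

  x+ᵅ-1·y≡0⇒x≡y : ∀ x y → x +ᵅ -1ℤ ·ᵅ y ≡ 0ᵅ → x ≡ y
  x+ᵅ-1·y≡0⇒x≡y ⟪ u , v ⟫ ⟪ s , t ⟫ eq with ⟪,⟫-injective eq
  ... | u-s≡0 , v-t≡0 = cong₂ ⟪_,_⟫ (i-j≡0⇒i≡j u s (trans (cong (_+_ u) (sym (-1*i≡-i s))) u-s≡0))
                                     (i-j≡0⇒i≡j v t (trans (cong (_+_ v) (sym (-1*i≡-i t))) v-t≡0))

  eval : Poly → ℤ[α]
  eval []      = 0ᵅ
  eval (a ∷ p) = ι a +ᵅ α *ᵅ eval p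

  eval-const : ∀ c → eval (const c) ≡ ι c
  eval-const c = cong₂ ⟪_,_⟫ (solve (c ∷ d ∷ [])) refl

  eval-⊕ : ∀ p q → eval (p ⊕ q) ≡ eval p +ᵅ eval q
  eval-⊕ []      q       = sym (+ᵅ-identityˡ _)
  eval-⊕ (a ∷ p) []      = sym (+ᵅ-identityʳ _)
  eval-⊕ (a ∷ p) (b ∷ q) =
    trans (cong (λ y → ι (a + b) +ᵅ α *ᵅ y) (eval-⊕ p q)) (horner-+ (eval p) (eval q))
    where
    horner-+ : ∀ x y → ι (a + b) +ᵅ α *ᵅ (x +ᵅ y) ≡ (ι a +ᵅ α *ᵅ x) +ᵅ (ι b +ᵅ α *ᵅ y)
    horner-+ ⟪ u , v ⟫ ⟪ s , t ⟫ =
      cong₂ ⟪_,_⟫ (solve (a ∷ b ∷ u ∷ v ∷ s ∷ t ∷ d ∷ [])) (solve (u ∷ v ∷ s ∷ t ∷ []))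

  eval-· : ∀ c p → eval (c · p) ≡ c ·ᵅ eval p
  eval-· c []      = sym (·ᵅ-zeroʳ c)
  eval-· c (a ∷ p) = trans (cong (λ y → ι (c * a) +ᵅ α *ᵅ y) (eval-· c p)) (horner-· (eval p))
    where
    horner-· : ∀ x → ι (c * a) +ᵅ α *ᵅ (c ·ᵅ x) ≡ c ·ᵅ (ι a +ᵅ α *ᵅ x)
    horner-· ⟪ u , v ⟫ =
      cong₂ ⟪_,_⟫ (solve (a ∷ c ∷ u ∷ v ∷ d ∷ [])) (solve (a ∷ c ∷ u ∷ v ∷ []))

  eval-⊛ : ∀ p q → eval (p ⊛ q) ≡ eval p *ᵅ eval q
  eval-⊛ []      q = sym (*ᵅ-zeroˡ (eval q))
  eval-⊛ (a ∷ p) q = begin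
    eval (a · q ⊕ (0ℤ ∷ p ⊛ q))                      ≡⟨ eval-⊕ (a · q) (0ℤ ∷ p ⊛ q) ⟩
    eval (a · q) +ᵅ (ι 0ℤ +ᵅ α *ᵅ eval (p ⊛ q))
      ≡⟨ cong₂ (λ y z → y +ᵅ (ι 0ℤ +ᵅ α *ᵅ z)) (eval-· a q) (eval-⊛ p q) ⟩
    a ·ᵅ eval q +ᵅ (ι 0ℤ +ᵅ α *ᵅ (eval p *ᵅ eval q)) ≡⟨ horner-* (eval p) (eval q) ⟩
    (ι a +ᵅ α *ᵅ eval p) *ᵅ eval q                   ∎
    where
    open ≡-Reasoning
    horner-* : ∀ x y → a ·ᵅ y +ᵅ (ι 0ℤ +ᵅ α *ᵅ (x *ᵅ y)) ≡ (ι a +ᵅ α *ᵅ x) *ᵅ y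
    horner-* ⟪ u , v ⟫ ⟪ s , t ⟫ =
      cong₂ ⟪_,_⟫ (solve (a ∷ u ∷ v ∷ s ∷ t ∷ d ∷ [])) (solve (a ∷ u ∷ v ∷ s ∷ t ∷ d ∷ []))

  eval-IsZero : ∀ {p} → IsZero p → eval p ≡ 0ᵅ
  eval-IsZero All.[]         = refl
  eval-IsZero (refl All.∷ z) =
    trans (cong (λ y → ι 0ℤ +ᵅ α *ᵅ y) (eval-IsZero z)) (eval-const 0ℤ)

  eval-resp-≈ₚ : ∀ p q → p ≈ₚ q → eval p ≡ eval q
  eval-resp-≈ₚ p q p≈q = x+ᵅ-1·y≡0⇒x≡y (eval p) (eval q) (begin
    eval p +ᵅ -1ℤ ·ᵅ eval q ≡⟨ cong (eval p +ᵅ_) (eval-· -1ℤ q) ⟨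
    eval p +ᵅ eval (⊖ q)    ≡⟨ eval-⊕ p (⊖ q) ⟨
    eval (p ⊕ ⊖ q)          ≡⟨ eval-IsZero p≈q ⟩
    0ᵅ                      ∎)
    where open ≡-Reasoning

  eval-X²+ : eval (X²+ d) ≡ 0ᵅ
  eval-X²+ = cong₂ ⟪_,_⟫ (solve (d ∷ [])) (solve (d ∷ []))

  pell⇒eval²≡-1 : ∀ P Q → PellSolution d P Q → eval P *ᵅ eval P ≡ ι -1ℤ
  pell⇒eval²≡-1 P Q sol = begin
    eval P *ᵅ eval P                                         ≡⟨ +ᵅ-identityʳ _ ⟨
    eval P *ᵅ eval P +ᵅ 0ᵅ                                   ≡⟨ cong (eval P *ᵅ eval P +ᵅ_) root-term ⟨
    eval P *ᵅ eval P +ᵅ -1ℤ ·ᵅ (eval (X²+ d) *ᵅ eval (Q ⊛ Q)) ≡⟨ eval-pell-lhs ⟨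
    eval (P ⊛ P ⊕ ⊖ (X²+ d ⊛ (Q ⊛ Q)))                       ≡⟨ eval-resp-≈ₚ _ (const -1ℤ) sol ⟩
    eval (const -1ℤ)                                         ≡⟨ eval-const -1ℤ ⟩
    ι -1ℤ                                                    ∎
    where
    open ≡-Reasoning
    root-term : -1ℤ ·ᵅ (eval (X²+ d) *ᵅ eval (Q ⊛ Q)) ≡ 0ᵅ
    root-term rewrite eval-X²+ | *ᵅ-zeroˡ (eval (Q ⊛ Q)) = ·ᵅ-zeroʳ -1ℤ
    eval-pell-lhs : eval (P ⊛ P ⊕ ⊖ (X²+ d ⊛ (Q ⊛ Q)))
                  ≡ eval P *ᵅ eval P +ᵅ -1ℤ ·ᵅ (eval (X²+ d) *ᵅ eval (Q ⊛ Q))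
    eval-pell-lhs = trans (eval-⊕ (P ⊛ P) _)
      (cong₂ _+ᵅ_ (eval-⊛ P P)
                  (trans (eval-· -1ℤ (X²+ d ⊛ (Q ⊛ Q)))
                         (cong (-1ℤ ·ᵅ_) (eval-⊛ (X²+ d) (Q ⊛ Q)))))

  x²≡-1⇒d≡1 : ∀ x → x *ᵅ x ≡ ι -1ℤ → d ≡ 1ℤ
  x²≡-1⇒d≡1 ⟪ u , v ⟫ eq with ⟪,⟫-injective eq
  ... | u²-dv²≡-1 , uv+vu≡0 with ij+ji≡0⇒i≡0∨j≡0 u v uv+vu≡0
  ... | inj₁ refl = i*[j*j]≡1⇒i≡1 d v (neg-injective (trans (sym (+-identityˡ _)) u²-dv²≡-1))
  ... | inj₂ refl = contradiction (trans u²≡u²-d0² u²-dv²≡-1) (i*i≢-1 u)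
    where
    u²≡u²-d0² : u * u ≡ u * u + - (d * (0ℤ * 0ℤ))
    u²≡u²-d0² = solve (u ∷ d ∷ [])

nontrivial-solution-for-1 : HasNontrivialSolution 1ℤ
nontrivial-solution-for-1 =
  0ℤ ∷ 1ℤ ∷ [] , 1ℤ ∷ [] , refl All.∷ refl All.∷ refl All.∷ All.[] , λ { (() All.∷ _) }

theorem1p2 : (d : ℤ) → HasNontrivialSolution d ⇔ (d ≡ + 1)
theorem1p2 d = mk⇔ (λ (P , Q , sol , _) → x²≡-1⇒d≡1 (eval P) (pell⇒eval²≡-1 P Q sol))
                   (λ { refl → nontrivial-solution-for-1 })
  where open Evaluation d
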